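{- Let $k\ge 2$ be an integer. If a graph $G$ is $k$-dense and connected, then $G$ is at least $(k-1)$-edge-connected, i.e. for every set $S$ of at most $k-2$ edges of $G$, the graph $G-S$ is connected.
   Context: All graphs are finite and simple. For an edge $uv$ of a graph $G$, the edge multiplicity is $m_G(uv)=|N_G(u)\cap N_G(v)|$. For an integer $k\ge 2$, a graph $G$ is called $k$-dense if $G$ has no isolated vertices and every edge $uv$ of $G$ satisfies $m_G(uv)\ge k-2$. -}

module Defs where

open import Data.Nat using (ℕ; _∸_; _≤_)
open import Data.Bool using (Bool; true; false; _∧_)
open import Data.Fin using (Fin)
open import Data.List using (List; length; filter)
open import Data.List.Base using (allFin)
open import Data.List.Membership.Propositional using (_∈_)
open import Data.Product using (_×_; _,_; ∃)
open import Data.Sum using (_⊎_)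
open import Relation.Nullary using (¬_)
open import Relation.Binary.PropositionalEquality using (_≡_)
open import Relation.Nullary.Decidable using (Dec)
open import Data.Bool.Properties using (T?)
open import Data.Bool using (T)

record Graph (n : ℕ) : Set where
  field
    adj   : Fin n → Fin n → Bool
    sym   : ∀ u v → adj u v ≡ adj v u
    irref : ∀ u → adj u u ≡ false
open Graph public

Edge : ∀ {n} → Graph n → Fin n → Fin n → Set
Edge G u v = adj G u v ≡ true

multiplicity : ∀ {n} → Graph n → Fin n → Fin n → ℕ
multiplicity {n} G u v = length (filter (λ w → T? (adj G u w ∧ adj G v w)) (allFin n))

Dense : ℕ → ∀ {n} → Graph n → Set
Dense k {n} G = (∀ u → ∃ λ v → Edge G u v)
              × (∀ u v → Edge G u v → k ∸ 2 ≤ multiplicity G u v)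

data Walk {n : ℕ} (R : Fin n → Fin n → Set) : Fin n → Fin n → Set where
  here : ∀ {u} → Walk R u u
  step : ∀ {u v w} → R u v → Walk R v w → Walk R u w

ConnectedRel : ∀ {n} → (Fin n → Fin n → Set) → Set
ConnectedRel {n} R = ∀ (u v : Fin n) → Walk R u v

Connected : ∀ {n} → Graph n → Set
Connected G = ConnectedRel (Edge G)

-- Edges given as (unordered) pairs; a list S of pairs
EdgeSet : ℕ → Set
EdgeSet n = List (Fin n × Fin n)

InEdgeSet : ∀ {n} → EdgeSet n → Fin n → Fin n → Set
InEdgeSet S u v = ((u , v) ∈ S) ⊎ ((v , u) ∈ S)

AdjMinus : ∀ {n} → Graph n → EdgeSet n → Fin n → Fin n → Set
AdjMinus G S u v = Edge G u v × ¬ InEdgeSet S u v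

module Submission where

-- A connected graph stays connected after deleting S as soon as
-- the two ends of every deleted edge uv remain joined in G - S, since then
-- each edge of a u–v walk in G can be rerouted inside G - S.  So fix an edge
-- uv ∈ S.  Every common neighbour w of u and v gives a path u – w – v, and
-- these paths are edge-disjoint from each other and from uv itself: an edge
-- of such a path joins its "outer" end w to one of u, v, so it determines w,
-- and it is never uv.  If every such path met S, then S would contain uv
-- together with one further edge per common neighbour, i.e. at least
-- m(uv) + 1 ≥ k - 1 edges, contradicting |S| ≤ k - 2.

open import Defs
open import Data.Nat using (ℕ; _≤_; _∸_; suc; z≤n; s≤s)
open import Data.Nat.Properties using (≤-trans; 1+n≰n)
open import Data.Bool using (true; _∧_; T)
open import Data.Bool.Properties using (T?)
open import Data.Fin using (Fin; _≟_)
open import Data.List using (List; []; _∷_; length; filter)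
open import Data.List.Base using (allFin)
open import Data.List.Properties using (length-removeAt′)
open import Data.List.Relation.Unary.All as All using (All; []; _∷_; all?)
open import Data.List.Relation.Unary.All.Properties using (¬All⇒Any¬)
open import Data.List.Relation.Unary.Any as Any using (Any; here; there; _─_; index)
open import Data.List.Relation.Unary.AllPairs using ([]; _∷_)
open import Data.List.Relation.Unary.Unique.Propositional using (Unique)
open import Data.List.Relation.Unary.Unique.Propositional.Properties using (allFin⁺; filter⁺)
open import Data.List.Membership.Propositional using (_∈_; find)
open import Data.List.Membership.Propositional.Properties using (∈-filter⁻)
open import Data.Product using (_×_; _,_; ∃; proj₁; proj₂; uncurry)
import Data.Product.Properties as Product
import Data.List.Membership.DecPropositional as DecMembership
open import Data.Sum using (_⊎_; inj₁; inj₂)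
open import Data.Empty using (⊥; ⊥-elim)
open import Relation.Nullary using (¬_; Dec; yes; no)
open import Relation.Nullary.Decidable using (_⊎-dec_)
open import Relation.Binary.PropositionalEquality
  using (_≡_; _≢_; refl; trans; subst)
  renaming (sym to ≡-sym)

private
  variable
    A B : Set

─-keep : ∀ {P Q : A → Set} {xs : List A} (p : Any P xs) →
         (∀ {z} → P z → Q z → ⊥) → Any Q xs → Any Q (xs ─ p)
─-keep (here pz)  disjoint (here qz) = ⊥-elim (disjoint pz qz)
─-keep (here pz)  disjoint (there q) = q
─-keep (there p)  disjoint (here qz) = here qz
─-keep (there p)  disjoint (there q) = there (─-keep p disjoint q)

≤-─ : ∀ {P : A → Set} {m} (xs : List A) (p : Any P xs) →
      m ≤ length (xs ─ p) → suc m ≤ length xs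
≤-─ xs p m≤ = subst (suc _ ≤_) (≡-sym (length-removeAt′ xs (index p))) (s≤s m≤)

witnesses-≤ : ∀ {W : A → B → Set} →
              (∀ {x y z} → W x z → W y z → x ≡ y) →
              ∀ {L : List A} (S : List B) → Unique L →
              All (λ x → Any (W x) S) L → length L ≤ length S
witnesses-≤ determines S [] [] = z≤n
witnesses-≤ {W = W} determines {x ∷ _} S (x∉L ∷ unique) (wx ∷ ws) =
  ≤-─ S wx (witnesses-≤ determines (S ─ wx) unique (All.zipWith survives (x∉L , ws)))
  where
  survives : ∀ {y} → x ≢ y × Any (W y) S → Any (W y) (S ─ wx)
  survives (x≢y , wy) = ─-keep wx (λ w w′ → x≢y (determines w w′)) wy

Crosses : (A → Set) → A → A × A → Set
Crosses T x (a , b) = ¬ T x × ((a ≡ x × T b) ⊎ (b ≡ x × T a))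

Within : (A → Set) → A × A → Set
Within T (a , b) = T a × T b

crossing-outer-end : ∀ {T : A → Set} {x y} (z : A × A) →
                     Crosses T x z → Crosses T y z → x ≡ y
crossing-outer-end _ (_ , inj₁ (refl , _))   (_ , inj₁ (refl , _))   = refl
crossing-outer-end _ (_ , inj₂ (refl , _))   (_ , inj₂ (refl , _))   = refl
crossing-outer-end _ (∉T , inj₁ (refl , _))  (_ , inj₂ (_ , ∈T))     = ⊥-elim (∉T ∈T)
crossing-outer-end _ (∉T , inj₂ (refl , _))  (_ , inj₁ (_ , ∈T))     = ⊥-elim (∉T ∈T)

crossing-not-within : ∀ {T : A → Set} {x} (z : A × A) →
                      Crosses T x z → ¬ Within T z
crossing-not-within _ (∉T , inj₁ (refl , _)) (∈T , _) = ∉T ∈T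
crossing-not-within _ (∉T , inj₂ (refl , _)) (_ , ∈T) = ∉T ∈T

inEdgeSet⇒Any : ∀ {n} {P : Fin n × Fin n → Set} {S : EdgeSet n} {a b} →
                P (a , b) → P (b , a) → InEdgeSet S a b → Any P S
inEdgeSet⇒Any pab pba (inj₁ ab∈S) = Any.map (λ { refl → pab }) ab∈S
inEdgeSet⇒Any pab pba (inj₂ ba∈S) = Any.map (λ { refl → pba }) ba∈S

inEdgeSet? : ∀ {n} (S : EdgeSet n) a b → Dec (InEdgeSet S a b)
inEdgeSet? {n} S a b = ((a , b) ∈? S) ⊎-dec ((b , a) ∈? S)
  where open DecMembership (Product.≡-dec (_≟_ {n}) (_≟_ {n})) using (_∈?_)

edge-irreflexive : ∀ {n} (G : Graph n) {u v} → Edge G u v → u ≢ v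
edge-irreflexive G {u} uv refl with trans (≡-sym uv) (irref G u)
... | ()

edge-sym : ∀ {n} (G : Graph n) {u v} → Edge G u v → Edge G v u
edge-sym G {u} {v} uv = trans (Graph.sym G v u) uv

∧-true : ∀ {a b} → T (a ∧ b) → a ≡ true × b ≡ true
∧-true {true} {true} _ = refl , refl

-- The common neighbours of u and v; by definition m_G(uv) is their number.
commonNeighbours : ∀ {n} → Graph n → Fin n → Fin n → List (Fin n)
commonNeighbours {n} G u v = filter (λ w → T? (adj G u w ∧ adj G v w)) (allFin n)

commonNeighbours-unique : ∀ {n} (G : Graph n) u v → Unique (commonNeighbours G u v)
commonNeighbours-unique {n} G u v = filter⁺ (λ w → T? (adj G u w ∧ adj G v w)) (allFin⁺ n)

commonNeighbour-edges : ∀ {n} (G : Graph n) {u v w} → w ∈ commonNeighbours G u v →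
                        Edge G u w × Edge G v w
commonNeighbour-edges {n} G {u} {v} w∈ =
  ∧-true (proj₂ (∈-filter⁻ (λ w → T? (adj G u w ∧ adj G v w)) {xs = allFin n} w∈))

Blocked : ∀ {n} → EdgeSet n → Fin n → Fin n → Fin n → Set
Blocked S u v w = InEdgeSet S u w ⊎ InEdgeSet S w v

blocked? : ∀ {n} (S : EdgeSet n) u v w → Dec (Blocked S u v w)
blocked? S u v w = inEdgeSet? S u w ⊎-dec inEdgeSet? S w v

EndOf : ∀ {n} → Fin n → Fin n → Fin n → Set
EndOf u v t = t ≡ u ⊎ t ≡ v

blocked⇒crossing : ∀ {n} {S : EdgeSet n} {u v w} → ¬ EndOf u v w →
                   Blocked S u v w → Any (Crosses (EndOf u v) w) S
blocked⇒crossing w∉ (inj₁ uw∈S) =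
  inEdgeSet⇒Any (w∉ , inj₂ (refl , inj₁ refl)) (w∉ , inj₁ (refl , inj₁ refl)) uw∈S
blocked⇒crossing w∉ (inj₂ wv∈S) =
  inEdgeSet⇒Any (w∉ , inj₁ (refl , inj₂ refl)) (w∉ , inj₂ (refl , inj₂ refl)) wv∈S

blocked-paths-bound : ∀ {n} (S : EdgeSet n) {u v} {L : List (Fin n)} →
                      Unique L → All (λ w → ¬ EndOf u v w) L →
                      All (Blocked S u v) L → InEdgeSet S u v →
                      suc (length L) ≤ length S
blocked-paths-bound S {u} {v} unique outside blocked uv∈S =
  ≤-─ S uvWithin
    (witnesses-≤ (λ {_} {_} {z} → crossing-outer-end z) (S ─ uvWithin)
                 unique (All.zipWith crossingSurvives (outside , blocked)))
  where
  uvWithin : Any (Within (EndOf u v)) S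
  uvWithin = inEdgeSet⇒Any (inj₁ refl , inj₂ refl) (inj₂ refl , inj₁ refl) uv∈S

  crossingSurvives : ∀ {w} → ¬ EndOf u v w × Blocked S u v w →
                     Any (Crosses (EndOf u v) w) (S ─ uvWithin)
  crossingSurvives (w∉ , b) =
    ─-keep uvWithin (λ {z} within cross → crossing-not-within z cross within)
           (blocked⇒crossing w∉ b)

free-common-neighbour : ∀ k {n} (G : Graph n) → Dense k G →
                        (S : EdgeSet n) → length S ≤ k ∸ 2 →
                        ∀ {u v} → Edge G u v → InEdgeSet S u v →
                        ∃ λ w → w ∈ commonNeighbours G u v × ¬ Blocked S u v w
free-common-neighbour k G (_ , dense) S |S|≤ {u} {v} uv uv∈S
  with all? (blocked? S u v) (commonNeighbours G u v)
... | no notAll = find (¬All⇒Any¬ (blocked? S u v) _ notAll)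
... | yes allBlocked = ⊥-elim (1+n≰n (≤-trans tooMany (≤-trans |S|≤ (dense u v uv))))
  where
  notEnd : ∀ {w} → w ∈ commonNeighbours G u v → ¬ EndOf u v w
  notEnd w∈ (inj₁ refl) = edge-irreflexive G (proj₁ (commonNeighbour-edges G w∈)) refl
  notEnd w∈ (inj₂ refl) = edge-irreflexive G (proj₂ (commonNeighbour-edges G w∈)) refl

  tooMany : suc (multiplicity G u v) ≤ length S
  tooMany = blocked-paths-bound S (commonNeighbours-unique G u v)
              (All.tabulate notEnd) allBlocked uv∈S

edge-bypass : ∀ k {n} (G : Graph n) → Dense k G →
              (S : EdgeSet n) → length S ≤ k ∸ 2 →
              ∀ {u v} → Edge G u v → Walk (AdjMinus G S) u v
edge-bypass k G D S |S|≤ {u} {v} uv with inEdgeSet? S u v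
... | no uv∉S = step (uv , uv∉S) here
... | yes uv∈S with free-common-neighbour k G D S |S|≤ uv uv∈S
... | w , w∈ , free =
  step (uw , λ uw∈S → free (inj₁ uw∈S)) (step (wv , λ wv∈S → free (inj₂ wv∈S)) here)
  where
  uw : Edge G u w
  uw = proj₁ (commonNeighbour-edges G w∈)
  wv : Edge G w v
  wv = edge-sym G (proj₂ (commonNeighbour-edges G w∈))

_++W_ : ∀ {n} {R : Fin n → Fin n → Set} {a b c} → Walk R a b → Walk R b c → Walk R a c
here     ++W q = q
step r p ++W q = step r (p ++W q)

reroute : ∀ {n} {R R′ : Fin n → Fin n → Set} →
          (∀ {a b} → R a b → Walk R′ a b) → ∀ {a b} → Walk R a b → Walk R′ a b
reroute bypass here       = here
reroute bypass (step r p) = bypass r ++W reroute bypass p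

proposition2p5 : (k : ℕ) → 2 ≤ k → ∀ {n} (G : Graph n) → Dense k G → Connected G →
    (S : EdgeSet n) → All (uncurry (Edge G)) S → length S ≤ k ∸ 2 →
    ConnectedRel (AdjMinus G S)
proposition2p5 k _ G D connected S _ |S|≤ u v =
  reroute (edge-bypass k G D S |S|≤) (connected u v)
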